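{- For any variable $x$ (and $y\neq x$), $\lambda y.xy\precsim_{type}x$ and $x\precsim_{type}\lambda y.xy$.
   Context: Multi types: linear $L::=M\multimap N$; multi $M,N::=[L_1,\dots,L_n]$ (finite multisets, $n\ge0$, union $\uplus$); typing contexts assign multi types to finitely many variables (others $[\,]$), $\uplus$ pointwise. Rules: $x:[L]\vdash x:L$; $\Gamma,x:M\vdash t:N\Rightarrow\Gamma\vdash\lambda x.t:M\multimap N$; $(\Gamma_i\vdash v:L_i)_{i\in I}$, $I$ finite, $v$ a value (variable or abstraction) $\Rightarrow\uplus_i\Gamma_i\vdash v:\uplus_i[L_i]$; $\Gamma\vdash t:[M\multimap N]$, $\Delta\vdash u:M\Rightarrow\Gamma\uplus\Delta\vdash tu:N$; $\Gamma,x:M\vdash t:N$, $\Delta\vdash u:M\Rightarrow\Gamma\uplus\Delta\vdash t[x\leftarrow u]:N$. Type preorder: $t\precsim_{type}t'$ iff for all $\Gamma$ and multi types $M$, derivability of $\Gamma\vdash t:M$ implies derivability of $\Gamma\vdash t':M$. -}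

module Defs where

open import Data.Nat using (ℕ; _≟_)
open import Data.List using (List; []; _∷_; [_]; _++_)
open import Data.Product using (_×_)
open import Relation.Nullary using (yes; no)

Var : Set
Var = ℕ

data Term : Set where
  var  : Var → Term
  lam  : Var → Term → Term
  app  : Term → Term → Term
  esub : Term → Var → Term → Term     -- esub t x u  =  t[x←u]

data Value : Term → Set where
  var-val : ∀ x → Value (var x)
  lam-val : ∀ x t → Value (lam x t)

-- Linear types L ::= M ⊸ N ; multi types M ::= finite multisets of linear
-- types, represented by lists and compared up to (deep) multiset equality ≈M.
data Lin : Set where
  _⊸_ : List Lin → List Lin → Lin

Multi : Set
Multi = List Lin

mutual
  data _≈L_ : Lin → Lin → Set where
    ⊸-cong : ∀ {M M′ N N′} → M ≈M M′ → N ≈M N′ → (M ⊸ N) ≈L (M′ ⊸ N′)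

  data _≈M_ : Multi → Multi → Set where
    []≈  : [] ≈M []
    ∷≈   : ∀ {L L′ M M₁ M₂} → L ≈L L′ → M ≈M (M₁ ++ M₂) →
           (L ∷ M) ≈M (M₁ ++ (L′ ∷ M₂))

-- Typing contexts: assign a multi type to every variable ([] for almost all)
Ctx : Set
Ctx = Var → Multi

∅ : Ctx
∅ _ = []

_⊎_ : Ctx → Ctx → Ctx
(Γ ⊎ Δ) z = Γ z ++ Δ z

_∶ₓ_ : Var → Multi → Ctx
(x ∶ₓ M) z with z ≟ x
... | yes _ = M
... | no  _ = []

-- Γ with x reset to []  (so that Γ = (Γ ∖ x) , x : Γ x)
_∖_ : Ctx → Var → Ctx
(Γ ∖ x) z with z ≟ x
... | yes _ = []
... | no  _ = Γ z

_≈C_ : Ctx → Ctx → Set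
Γ ≈C Δ = ∀ z → Γ z ≈M Δ z

mutual
  data _⊢L_∶_ : Ctx → Term → Lin → Set where
    ax  : ∀ {x L} → (x ∶ₓ [ L ]) ⊢L var x ∶ L
    abs : ∀ {Γ x t N} → Γ ⊢M t ∶ N → (Γ ∖ x) ⊢L lam x t ∶ (Γ x ⊸ N)

  -- family (Γᵢ ⊢ v : Lᵢ)_{i∈I} collected into ⊎ᵢ Γᵢ and ⊎ᵢ [Lᵢ]
  data Many : Ctx → Term → Multi → Set where
    many-nil  : ∀ {v} → Many ∅ v []
    many-cons : ∀ {Γ Δ v L M} → Γ ⊢L v ∶ L → Many Δ v M → Many (Γ ⊎ Δ) v (L ∷ M)

  data _⊢M_∶_ : Ctx → Term → Multi → Set where
    many : ∀ {Γ v M} → Value v → Many Γ v M → Γ ⊢M v ∶ M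
    appT : ∀ {Γ Δ t u M N} → Γ ⊢M t ∶ [ M ⊸ N ] → Δ ⊢M u ∶ M →
           (Γ ⊎ Δ) ⊢M app t u ∶ N
    esT  : ∀ {Γ Δ t x u N} → Γ ⊢M t ∶ N → Δ ⊢M u ∶ Γ x →
           ((Γ ∖ x) ⊎ Δ) ⊢M esub t x u ∶ N
    -- multisets are taken up to equality (quotient made explicit)
    conv : ∀ {Γ Γ′ t M M′} → Γ ⊢M t ∶ M → Γ ≈C Γ′ → M ≈M M′ → Γ′ ⊢M t ∶ M′

_≾type_ : Term → Term → Set
t ≾type t′ = ∀ (Γ : Ctx) (M : Multi) → Γ ⊢M t ∶ M → Γ ⊢M t′ ∶ M

-- λy.xy and x are both values, and a multi typing of a value is a multiset of
-- linear typings, so it suffices to move single linear typings across.  A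
-- linear typing of x is the axiom x : [A ⊸ N] ⊢ x : A ⊸ N, and typing y at A
-- gives x : [A ⊸ N] ⊢ λy.xy : A ⊸ N.  Conversely, a typing Δ ⊢ x y : N
-- forces y to be typed by exactly Δ(y) and x by [Δ(y) ⊸ N] in the rest of Δ,
-- so the linear type Δ(y) ⊸ N of λy.xy is also a type of x.
module Submission where

open import Defs
open import Data.Nat using (_≟_)
open import Data.List using (List; []; _∷_; [_]; _++_)
open import Data.List.Properties using (++-assoc; ++-identityʳ; ∷-injective)
open import Data.Product using (_×_; _,_; Σ-syntax)
open import Data.Sum using (inj₁; inj₂) renaming (_⊎_ to _⊎ˢ_)
open import Data.Empty using (⊥-elim)
open import Function using (case_of_)
open import Relation.Nullary using (yes; no)
open import Relation.Binary.PropositionalEquality using (_≡_; _≢_; refl; sym; trans; cong; subst)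

mutual
  ≈L-refl : ∀ L → L ≈L L
  ≈L-refl (M ⊸ N) = ⊸-cong (≈M-refl M) (≈M-refl N)

  ≈M-refl : ∀ M → M ≈M M
  ≈M-refl []      = []≈
  ≈M-refl (L ∷ M) = ∷≈ {M₁ = []} (≈L-refl L) (≈M-refl M)

≈M-reflexive : ∀ {M M′} → M ≡ M′ → M ≈M M′
≈M-reflexive {M} refl = ≈M-refl M

≈M-∷ : ∀ {L L′ M M′} → L ≈L L′ → M ≈M M′ → (L ∷ M) ≈M (L′ ∷ M′)
≈M-∷ = ∷≈ {M₁ = []}

≈M-insert : ∀ M₁ {M₂ L L′ M} → L ≈L L′ → (M₁ ++ M₂) ≈M M → (M₁ ++ L ∷ M₂) ≈M (L′ ∷ M)
≈M-insert []        L≈ M≈                   = ≈M-∷ L≈ M≈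
≈M-insert (_ ∷ M₁) {L′ = L′} L≈ (∷≈ {M₁ = P₁} K≈ M≈) = ∷≈ {M₁ = L′ ∷ P₁} K≈ (≈M-insert M₁ L≈ M≈)

mutual
  ≈L-sym : ∀ {L L′} → L ≈L L′ → L′ ≈L L
  ≈L-sym (⊸-cong M≈ N≈) = ⊸-cong (≈M-sym M≈) (≈M-sym N≈)

  ≈M-sym : ∀ {M M′} → M ≈M M′ → M′ ≈M M
  ≈M-sym []≈                     = []≈
  ≈M-sym (∷≈ {M₁ = M₁} L≈ M≈) = ≈M-insert M₁ (≈L-sym L≈) (≈M-sym M≈)

++-∷-split : ∀ {A : Set} (xs : List A) {ys us a vs} → xs ++ ys ≡ us ++ a ∷ vs →
  (Σ[ ws ∈ List A ] (xs ≡ us ++ a ∷ ws × vs ≡ ws ++ ys)) ⊎ˢ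
  (Σ[ ws ∈ List A ] (ys ≡ ws ++ a ∷ vs × us ≡ xs ++ ws))
++-∷-split []       {us = us} eq = inj₂ (us , eq , refl)
++-∷-split (x ∷ xs) {us = []} refl = inj₁ (xs , refl , refl)
++-∷-split (x ∷ xs) {us = u ∷ us} eq with ∷-injective eq
... | refl , eq′ with ++-∷-split xs eq′
... | inj₁ (ws , refl , vs≡) = inj₁ (ws , refl , vs≡)
... | inj₂ (ws , ys≡ , refl) = inj₂ (ws , ys≡ , refl)

≈M-remove : ∀ M₁ {L M₂ P} → (M₁ ++ L ∷ M₂) ≈M P →
  Σ[ P₁ ∈ Multi ] Σ[ P₂ ∈ Multi ] Σ[ L′ ∈ Lin ]
    (P ≡ P₁ ++ L′ ∷ P₂ × L ≈L L′ × (M₁ ++ M₂) ≈M (P₁ ++ P₂))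
≈M-remove [] (∷≈ {M₁ = P₁} {M₂ = P₂} L≈ M≈) = P₁ , P₂ , _ , refl , L≈ , M≈
≈M-remove (K ∷ M₁) {M₂ = M₂} (∷≈ {L′ = K′} {M₁ = S₁} {M₂ = S₂} K≈ M≈)
  with ≈M-remove M₁ M≈
... | T₁ , T₂ , L′ , eq , L≈ , M≈′ with ++-∷-split S₁ eq
... | inj₁ (U , refl , refl) =
  T₁ , U ++ K′ ∷ S₂ , L′ , ++-assoc T₁ (L′ ∷ U) (K′ ∷ S₂) , L≈ ,
  subst ((K ∷ M₁ ++ M₂) ≈M_) (++-assoc T₁ U (K′ ∷ S₂))
    (∷≈ {M₁ = T₁ ++ U} K≈ (subst ((M₁ ++ M₂) ≈M_) (sym (++-assoc T₁ U S₂)) M≈′))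
... | inj₂ (U , refl , refl) =
  S₁ ++ K′ ∷ U , T₂ , L′ , sym (++-assoc S₁ (K′ ∷ U) (L′ ∷ T₂)) , L≈ ,
  subst ((K ∷ M₁ ++ M₂) ≈M_) (sym (++-assoc S₁ (K′ ∷ U) T₂))
    (∷≈ {M₁ = S₁} K≈ (subst ((M₁ ++ M₂) ≈M_) (++-assoc S₁ U T₂) M≈′))

mutual
  ≈L-trans : ∀ L {L′ L″} → L ≈L L′ → L′ ≈L L″ → L ≈L L″
  ≈L-trans (M ⊸ N) (⊸-cong M≈ N≈) (⊸-cong M≈′ N≈′) =
    ⊸-cong (≈M-trans M M≈ M≈′) (≈M-trans N N≈ N≈′)

  ≈M-trans : ∀ M {M′ M″} → M ≈M M′ → M′ ≈M M″ → M ≈M M″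
  ≈M-trans []      []≈                  M≈′ = M≈′
  ≈M-trans (L ∷ M) (∷≈ {M₁ = M₁} L≈ M≈) M≈′ with ≈M-remove M₁ M≈′
  ... | P₁ , _ , _ , refl , L≈′ , M≈″ = ∷≈ {M₁ = P₁} (≈L-trans L L≈ L≈′) (≈M-trans M M≈ M≈″)

++⁺ˡ : ∀ P {M M′} → M ≈M M′ → (P ++ M) ≈M (P ++ M′)
++⁺ˡ []      M≈ = M≈
++⁺ˡ (L ∷ P) M≈ = ≈M-∷ (≈L-refl L) (++⁺ˡ P M≈)

++⁺ʳ : ∀ P {M M′} → M ≈M M′ → (M ++ P) ≈M (M′ ++ P)
++⁺ʳ P []≈ = ≈M-refl P
++⁺ʳ P {L ∷ M} (∷≈ {L′ = L′} {M₁ = M₁} {M₂ = M₂} L≈ M≈) =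
  subst ((L ∷ M ++ P) ≈M_) (sym (++-assoc M₁ (L′ ∷ M₂) P))
    (∷≈ {M₁ = M₁} L≈ (subst ((M ++ P) ≈M_) (++-assoc M₁ M₂ P) (++⁺ʳ P M≈)))

≈M-[]-inv : ∀ {M} → [] ≈M M → M ≡ []
≈M-[]-inv []≈ = refl

∶ₓ-self : ∀ x M → (x ∶ₓ M) x ≡ M
∶ₓ-self x M with x ≟ x
... | yes _  = refl
... | no x≢x = ⊥-elim (x≢x refl)

∶ₓ-other : ∀ {x M z} → z ≢ x → (x ∶ₓ M) z ≡ []
∶ₓ-other {x} {z = z} z≢x with z ≟ x
... | yes z≡x = ⊥-elim (z≢x z≡x)
... | no _    = refl

∶ₓ-[] : ∀ x z → (x ∶ₓ []) z ≡ []
∶ₓ-[] x z with z ≟ x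
... | yes _ = refl
... | no _  = refl

∶ₓ-++ : ∀ x A B z → (x ∶ₓ A) z ++ (x ∶ₓ B) z ≡ (x ∶ₓ (A ++ B)) z
∶ₓ-++ x A B z with z ≟ x
... | yes _ = refl
... | no _  = refl

∶ₓ-cong : ∀ x {M M′} → M ≈M M′ → (x ∶ₓ M) ≈C (x ∶ₓ M′)
∶ₓ-cong x M≈ z with z ≟ x
... | yes _ = M≈
... | no _  = []≈

∖-self : ∀ Γ x → (Γ ∖ x) x ≡ []
∖-self Γ x with x ≟ x
... | yes _  = refl
... | no x≢x = ⊥-elim (x≢x refl)

∖-other : ∀ Γ {x z} → z ≢ x → (Γ ∖ x) z ≡ Γ z
∖-other Γ {x} {z} z≢x with z ≟ x
... | yes z≡x = ⊥-elim (z≢x z≡x)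
... | no _    = refl

∖-cong : ∀ {Γ Γ′} x → Γ ≈C Γ′ → (Γ ∖ x) ≈C (Γ′ ∖ x)
∖-cong x Γ≈ z with z ≟ x
... | yes _ = []≈
... | no _  = Γ≈ z

∷-⊢ : ∀ {Γ Δ v L M} → Γ ⊢L v ∶ L → Δ ⊢M v ∶ M → (Γ ⊎ Δ) ⊢M v ∶ (L ∷ M)
∷-⊢ D (many w Ds) = many w (many-cons D Ds)
∷-⊢ {Γ} {L = L} D (conv E Δ≈ M≈) =
  conv (∷-⊢ D E) (λ z → ++⁺ˡ (Γ z) (Δ≈ z)) (≈M-∷ (≈L-refl L) M≈)
∷-⊢ () (appT _ _)
∷-⊢ () (esT _ _)

mutual
  ⊢-++ : ∀ {Γ₁ Γ₂ v M₁ M₂} → Value v →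
    Γ₁ ⊢M v ∶ M₁ → Γ₂ ⊢M v ∶ M₂ → (Γ₁ ⊎ Γ₂) ⊢M v ∶ (M₁ ++ M₂)
  ⊢-++ w (many _ Ds) E = Many-++ w Ds E
  ⊢-++ {Γ₂ = Γ₂} {M₂ = M₂} w (conv D Γ≈ M≈) E =
    conv (⊢-++ w D E) (λ z → ++⁺ʳ (Γ₂ z) (Γ≈ z)) (++⁺ʳ M₂ M≈)
  ⊢-++ () (appT _ _) _
  ⊢-++ () (esT _ _) _

  Many-++ : ∀ {Γ₁ Γ₂ v M₁ M₂} → Value v →
    Many Γ₁ v M₁ → Γ₂ ⊢M v ∶ M₂ → (Γ₁ ⊎ Γ₂) ⊢M v ∶ (M₁ ++ M₂)
  Many-++ w many-nil E = E
  Many-++ {Γ₂ = Γ₂} {M₂ = M₂} w (many-cons {Γ} {Δ} {L = L} {M} D Ds) E =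
    conv (∷-⊢ D (Many-++ w Ds E))
         (λ z → ≈M-reflexive (sym (++-assoc (Γ z) (Δ z) (Γ₂ z))))
         (≈M-refl (L ∷ M ++ M₂))

module _ {v v′} (w′ : Value v′) (linear : ∀ {Γ L} → Γ ⊢L v ∶ L → Γ ⊢M v′ ∶ [ L ]) where

  mutual
    lift-⊢ : ∀ {Γ M} → Value v → Γ ⊢M v ∶ M → Γ ⊢M v′ ∶ M
    lift-⊢ _ (many _ Ds)    = lift-Many Ds
    lift-⊢ w (conv D Γ≈ M≈) = conv (lift-⊢ w D) Γ≈ M≈
    lift-⊢ () (appT _ _)
    lift-⊢ () (esT _ _)

    lift-Many : ∀ {Γ M} → Many Γ v M → Γ ⊢M v′ ∶ M
    lift-Many many-nil         = many w′ many-nil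
    lift-Many (many-cons D Ds) = ⊢-++ w′ (linear D) (lift-Many Ds)

  value-≾type : Value v → v ≾type v′
  value-≾type w _ _ = lift-⊢ w

var-⊢ : ∀ x A → (x ∶ₓ A) ⊢M var x ∶ A
var-⊢ x []      = conv (many (var-val x) many-nil) (λ z → ≈M-reflexive (sym (∶ₓ-[] x z))) []≈
var-⊢ x (L ∷ A) =
  conv (∷-⊢ ax (var-⊢ x A)) (λ z → ≈M-reflexive (∶ₓ-++ x [ L ] A z)) (≈M-refl (L ∷ A))

mutual
  var-inversion : ∀ {Γ x M} → Γ ⊢M var x ∶ M → Γ ≈C (x ∶ₓ M)
  var-inversion (many _ Ds) = var-inversion-Many Ds
  var-inversion {x = x} (conv D Γ≈ M≈) z =
    ≈M-trans _ (≈M-sym (Γ≈ z)) (≈M-trans _ (var-inversion D z) (∶ₓ-cong x M≈ z))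

  var-inversion-Many : ∀ {Γ x M} → Many Γ (var x) M → Γ ≈C (x ∶ₓ M)
  var-inversion-Many {x = x} many-nil z = ≈M-reflexive (sym (∶ₓ-[] x z))
  var-inversion-Many {x = x} {M = L ∷ M} (many-cons ax Ds) z =
    ≈M-trans _ (++⁺ˡ ((x ∶ₓ [ L ]) z) (var-inversion-Many Ds z))
               (≈M-reflexive (∶ₓ-++ x [ L ] M z))

var-⊢-other : ∀ {Γ x M z} → Γ ⊢M var x ∶ M → z ≢ x → Γ z ≡ []
var-⊢-other {Γ} {z = z} D z≢x =
  ≈M-[]-inv (≈M-sym (subst (Γ z ≈M_) (∶ₓ-other z≢x) (var-inversion D z)))

module _ (x y : Var) (y≢x : y ≢ x) where

  η-expansion : ∀ {Γ L} → Γ ⊢L var x ∶ L → Γ ⊢M lam y (app (var x) (var y)) ∶ [ L ]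
  η-expansion (ax {L = A ⊸ N}) =
    conv (many (lam-val y _) (many-cons (abs body) many-nil)) ctx
         (≈M-∷ (⊸-cong (≈M-reflexive dom) (≈M-refl N)) []≈)
    where
    Γ : Ctx
    Γ = (x ∶ₓ [ A ⊸ N ]) ⊎ (y ∶ₓ A)

    body : Γ ⊢M app (var x) (var y) ∶ N
    body = appT (var-⊢ x [ A ⊸ N ]) (var-⊢ y A)

    dom : Γ y ≡ A
    dom = trans (cong (_++ (y ∶ₓ A) y) (∶ₓ-other y≢x)) (∶ₓ-self y A)

    ctx : ((Γ ∖ y) ⊎ ∅) ≈C (x ∶ₓ [ A ⊸ N ])
    ctx z = case z ≟ y of λ where
      (yes refl) → ≈M-reflexive (trans (++-identityʳ _)
                     (trans (∖-self Γ y) (sym (∶ₓ-other y≢x))))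
      (no z≢y)   → ≈M-reflexive (trans (++-identityʳ _) (trans (∖-other Γ z≢y)
                       (trans (cong ((x ∶ₓ [ A ⊸ N ]) z ++_) (∶ₓ-other z≢y)) (++-identityʳ _))))

  η-body-inversion : ∀ {Δ N} → Δ ⊢M app (var x) (var y) ∶ N → (Δ ∖ y) ⊢M var x ∶ [ Δ y ⊸ N ]
  η-body-inversion (many () _)
  η-body-inversion (conv D Δ≈ N≈) =
    conv (η-body-inversion D) (∖-cong y Δ≈) (≈M-∷ (⊸-cong (Δ≈ y) N≈) []≈)
  η-body-inversion (appT {Γ = Γ} {Δ = Δ} {M = M} {N = N} D E) = conv D ctx type
    where
    Γy≡[] : Γ y ≡ []
    Γy≡[] = var-⊢-other D y≢x

    ctx : Γ ≈C ((Γ ⊎ Δ) ∖ y)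
    ctx z = case z ≟ y of λ where
      (yes refl) → ≈M-reflexive (trans Γy≡[] (sym (∖-self (Γ ⊎ Δ) y)))
      (no z≢y)   → ≈M-reflexive (sym (trans (∖-other (Γ ⊎ Δ) z≢y)
                       (trans (cong (Γ z ++_) (var-⊢-other E z≢y)) (++-identityʳ _))))

    Δy≈M : Δ y ≈M M
    Δy≈M = subst (Δ y ≈M_) (∶ₓ-self y M) (var-inversion E y)

    type : [ M ⊸ N ] ≈M [ (Γ y ++ Δ y) ⊸ N ]
    type rewrite Γy≡[] = ≈M-∷ (⊸-cong (≈M-sym Δy≈M) (≈M-refl N)) []≈

  η-reduction : ∀ {Γ L} → Γ ⊢L lam y (app (var x) (var y)) ∶ L → Γ ⊢M var x ∶ [ L ]
  η-reduction (abs D) = η-body-inversion D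

proposition12p8 : ∀ (x y : Var) → y ≢ x →
    (lam y (app (var x) (var y)) ≾type var x) × (var x ≾type lam y (app (var x) (var y)))
proposition12p8 x y y≢x =
    value-≾type (var-val x) (η-reduction x y y≢x) (lam-val y _)
  , value-≾type (lam-val y _) (η-expansion x y y≢x) (var-val x)
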